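{- Let $n\ge 1$, let $s_1,\dots,s_n$ be the adjacent transpositions of $S_{n+1}$ ($s_i$ swaps positions $i$ and $i+1$), and for $t\ge 0$ let $\pi=s_{i_1}\cdots s_{i_t}$ with $i_1,\dots,i_t$ independent and uniform in $\{1,\dots,n\}$. For $i\ne j$ in $\{1,\dots,n+1\}$ let $p^{(t)}_{ij}=\Pr(\pi_i<\pi_j)$. Let $G_n$ be the graph with vertex set $\{(i,j):1\le i,j\le n+1,\ i\ne j\}$ in which $(i,j)$ and $(i',j')$ are adjacent if $|i-i'|+|j-j'|=1$, and additionally $(j,j+1)$ and $(j+1,j)$ are adjacent for each $1\le j\le n$. Then for every $t\ge 0$ and every vertex $v$ of $G_n$, $$p^{(t+1)}_v=p^{(t)}_v+\frac{1}{n}\sum_{w\sim v}\left(p^{(t)}_w-p^{(t)}_v\right),$$ the sum running over the neighbours $w$ of $v$ in $G_n$; i.e. the sequence of matrices $(p^{(t)}_{ij})$, $t=0,1,2,\dots$, is a heat flow process on $G_n$ with conductivity $x=1/n$. Moreover, the expected number of inversions of $\pi$ equals $\sum_{i>j}p^{(t)}_{ij}$, the total heat below the diagonal.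
   Context: An inversion of a permutation $\pi$ (as a word $\pi_1\cdots\pi_{n+1}$) is a pair of positions $i<j$ with $\pi_i>\pi_j$. At $t=0$, $\pi$ is the identity, so $p^{(0)}_{ij}=1$ for $i<j$ and $0$ for $i>j$. -}

module Defs where

open import Data.Nat as ℕ using (ℕ; zero; suc; _^_; NonZero)
open import Data.Nat.Properties using (m^n≢0)
open import Data.Fin using (Fin; zero; suc; inject₁; toℕ; _<?_)
open import Data.Fin.Properties using (_≟_; any?)
open import Data.List using (List; []; _∷_; [_]; map; concatMap; filter; length; allFin; foldr)
open import Data.Nat.ListAction using (sum)
open import Data.Vec using (Vec; []; _∷_)
open import Data.Product using (Σ; _×_; _,_; ∃)
open import Data.Sum using (_⊎_)
open import Data.Integer using (+_)
open import Data.Rational as ℚ using (ℚ; _/_)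
import Data.Rational.Properties as ℚP
open import Relation.Binary.PropositionalEquality using (_≡_; _≢_)
open import Relation.Nullary using (Dec; yes; no; ¬_)
open import Relation.Nullary.Decidable using (_⊎-dec_; _×-dec_; ¬?)
open import Function using (id; _∘_)

-- S_{n+1} acts on Fin (suc n) = {1,…,n+1} (0-based).  The adjacent transposition
-- s_k, k : Fin n (k = 0 ↦ s_1), swaps positions k and k+1.
s : {n : ℕ} → Fin n → Fin (suc n) → Fin (suc n)
s k x with x ≟ inject₁ k
... | yes _ = suc k
... | no _ with x ≟ suc k
...   | yes _ = inject₁ k
...   | no _ = x

word : {n t : ℕ} → Vec (Fin n) t → Fin (suc n) → Fin (suc n)
word [] = id
word (k ∷ ks) = s k ∘ word ks

-- all index sequences (i_1,…,i_t) ∈ {1,…,n}^t  (uniform, each of weight 1/n^t)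
allSeqs : (n t : ℕ) → List (Vec (Fin n) t)
allSeqs n zero = [ [] ]
allSeqs n (suc t) = concatMap (λ k → map (k ∷_) (allSeqs n t)) (allFin n)

allPairs : (m : ℕ) → List (Fin m × Fin m)
allPairs m = concatMap (λ a → map (a ,_) (allFin m)) (allFin m)

p : (n : ℕ) → .{{NonZero n}} → ℕ → Fin (suc n) → Fin (suc n) → ℚ
p n {{nz}} t i j =
  _/_ (+ length (filter (λ ks → word ks i <? word ks j) (allSeqs n t)))
      (n ^ t) {{m^n≢0 n t {{nz}}}}

inversions : {n t : ℕ} → Vec (Fin n) t → ℕ
inversions {n} ks =
  length (filter (λ ab → let (a , b) = ab in (a <? b) ×-dec (word ks b <? word ks a))
                 (allPairs (suc n)))

expectedInversions : (n : ℕ) → .{{NonZero n}} → ℕ → ℚ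
expectedInversions n {{nz}} t =
  _/_ (+ sum (map inversions (allSeqs n t))) (n ^ t) {{m^n≢0 n t {{nz}}}}

dist : ℕ → ℕ → ℕ
dist a b = (a ℕ.∸ b) ℕ.+ (b ℕ.∸ a)

-- adjacency (for vertices; off-diagonality of both ends is imposed separately):
-- |i - i'| + |j - j'| = 1, or {v , w} = {(j , j+1) , (j+1 , j)} for some 1 ≤ j ≤ n
Adj : (n : ℕ) → Fin (suc n) × Fin (suc n) → Fin (suc n) × Fin (suc n) → Set
Adj n (i , j) (i' , j') =
  (dist (toℕ i) (toℕ i') ℕ.+ dist (toℕ j) (toℕ j') ≡ 1)
  ⊎ ∃ λ (k : Fin n) →
      ((i ≡ inject₁ k × j ≡ suc k) × (i' ≡ suc k × j' ≡ inject₁ k))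
      ⊎ ((i ≡ suc k × j ≡ inject₁ k) × (i' ≡ inject₁ k × j' ≡ suc k))

adj? : (n : ℕ) → (v w : Fin (suc n) × Fin (suc n)) → Dec (Adj n v w)
adj? n (i , j) (i' , j') =
  (dist (toℕ i) (toℕ i') ℕ.+ dist (toℕ j) (toℕ j') ℕ.≟ 1)
  ⊎-dec any? (λ k → ((i ≟ inject₁ k ×-dec j ≟ suc k) ×-dec (i' ≟ suc k ×-dec j' ≟ inject₁ k))
                 ⊎-dec ((i ≟ suc k ×-dec j ≟ inject₁ k) ×-dec (i' ≟ inject₁ k ×-dec j' ≟ suc k)))

neighbours : (n : ℕ) → Fin (suc n) × Fin (suc n) → List (Fin (suc n) × Fin (suc n))
neighbours n v =
  filter (λ w → let (i' , j') = w in ¬? (i' ≟ j') ×-dec adj? n v w) (allPairs (suc n))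

Σℚ : List ℚ → ℚ
Σℚ = foldr ℚ._+_ ℚ.0ℚ

heatBelowDiagonal : (n : ℕ) → .{{NonZero n}} → ℕ → ℚ
heatBelowDiagonal n t =
  Σℚ (map (λ ij → let (i , j) = ij in p n t i j)
             (filter (λ ij → let (i , j) = ij in j <? i) (allPairs (suc n))))

module Submission where

-- Split a word of length t+1 as a word of length t followed by the transposition s_k that
-- acts first on positions: k is uniform and independent of the rest, so
-- p^(t+1)_v = (1/n) Σ_k p^(t)_(s_k v), with s_k acting on both coordinates of the cell v.
-- For an off-diagonal v the cells s_k v ≠ v are exactly the neighbours of v in G_n, each
-- reached by a single k (the smaller of a moved coordinate and its image), and the other
-- k fix v; subtracting p^(t)_v from every term gives the heat equation.  The number of
-- inversions is a sum of indicators over pairs a < b, so exchanging the sums over words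
-- and pairs turns its expectation into Σ_(a<b) Pr(π_b < π_a) = Σ_(i>j) p_ij.

open import Defs
open import Data.Nat using (ℕ; suc; NonZero)
open import Data.Fin using (Fin)
open import Data.Product using (_×_; _,_; proj₁; proj₂)
open import Data.List using (map)
open import Data.Integer using (+_)
open import Data.Rational using (ℚ; _/_; _+_; _-_; _*_)
open import Relation.Binary.PropositionalEquality using (_≡_; _≢_)

open import Algebra.Bundles using (CommutativeMonoid)
open import Data.Bool using (true; false; if_then_else_)
open import Data.Fin using (zero; suc; inject₁; toℕ; _<_; _<?_)
open import Data.Fin.Properties using (_≟_; toℕ-inject₁; toℕ-injective; suc-injective)
import Data.Integer as ℤ
import Data.Integer.Properties as ℤP
open import Data.List using (List; []; _∷_; _++_; foldr; concatMap; filter; allFin; length)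
import Data.List.Properties as ListP
open import Data.Nat as ℕ using (zero; _⊓_; _∸_; _^_)
import Data.Nat.Properties as ℕP
open import Data.Nat.Tactic.RingSolver using (solve-∀)
open import Data.Product using (∃)
open import Data.Product.Properties using (≡-dec)
open import Data.Rational as ℚ using (fromℚᵘ)
import Data.Rational.Properties as ℚP
open import Algebra.Properties.Group ℚP.+-0-group using (//-rightDividesˡ)
open import Data.Rational.Unnormalised as ℚᵘ using (mkℚᵘ; *≡*)
import Data.Rational.Unnormalised.Properties as ℚᵘP
open import Data.Sum using (_⊎_; inj₁; inj₂)
open import Data.Vec using (Vec; []; _∷_; _∷ʳ_)
open import Function using (_∘_; id)
open import Relation.Binary.PropositionalEquality using (refl; sym; trans; cong; cong₂; module ≡-Reasoning)
open import Relation.Nullary using (Dec; does; yes; no; ¬_; contradiction)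
open import Relation.Nullary.Decidable using (¬?; _×-dec_)

module ListSum {c ℓ} (M : CommutativeMonoid c ℓ) where

  open CommutativeMonoid M renaming (refl to ≈-refl; sym to ≈-sym; trans to ≈-trans)
  open import Algebra.Properties.CommutativeSemigroup commutativeSemigroup using (interchange)
  open import Relation.Binary.Reasoning.Setoid setoid

  sum : {A : Set} → (A → Carrier) → List A → Carrier
  sum f xs = foldr _∙_ ε (map f xs)

  when : ∀ {p} {P : Set p} → Dec P → Carrier → Carrier
  when P? x = if does P? then x else ε

  when-yes : ∀ {p} {P : Set p} (P? : Dec P) {x} → P → when P? x ≈ x
  when-yes (yes _) _ = ≈-refl
  when-yes (no ¬p) p = contradiction p ¬p

  when-no : ∀ {p} {P : Set p} (P? : Dec P) {x} → ¬ P → when P? x ≈ ε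
  when-no (yes p) ¬p = contradiction p ¬p
  when-no (no _) _ = ≈-refl

  when-ε : ∀ {p} {P : Set p} (P? : Dec P) {x} → x ≈ ε → when P? x ≈ ε
  when-ε (yes _) x≈ε = x≈ε
  when-ε (no _) _ = ≈-refl

  when-×-dec : ∀ {p q} {P : Set p} {Q : Set q} (P? : Dec P) (Q? : Dec Q) x → when (P? ×-dec Q?) x ≈ when P? (when Q? x)
  when-×-dec (yes _) Q? x = ≈-refl
  when-×-dec (no _) Q? x = ≈-refl

  sum-cong : ∀ {A} {f g : A → Carrier} xs → (∀ x → f x ≈ g x) → sum f xs ≈ sum g xs
  sum-cong [] _ = ≈-refl
  sum-cong (x ∷ xs) f≈g = ∙-cong (f≈g x) (sum-cong xs f≈g)

  sum-ε : ∀ {A} {f : A → Carrier} xs → (∀ x → f x ≈ ε) → sum f xs ≈ ε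
  sum-ε [] _ = ≈-refl
  sum-ε (x ∷ xs) f≈ε = ≈-trans (∙-cong (f≈ε x) (sum-ε xs f≈ε)) (identityˡ ε)

  sum-when : ∀ {A p} {P : Set p} (P? : Dec P) (f : A → Carrier) xs → sum (λ x → when P? (f x)) xs ≈ when P? (sum f xs)
  sum-when (yes _) f xs = ≈-refl
  sum-when (no _) f xs = sum-ε xs (λ _ → ≈-refl)

  sum-∙ : ∀ {A} (f g : A → Carrier) xs → sum (λ x → f x ∙ g x) xs ≈ sum f xs ∙ sum g xs
  sum-∙ f g [] = ≈-sym (identityˡ ε)
  sum-∙ f g (x ∷ xs) = ≈-trans (∙-congˡ (sum-∙ f g xs)) (interchange _ _ _ _)

  sum-++ : ∀ {A} (f : A → Carrier) xs ys → sum f (xs ++ ys) ≈ sum f xs ∙ sum f ys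
  sum-++ f [] ys = ≈-sym (identityˡ _)
  sum-++ f (x ∷ xs) ys = ≈-trans (∙-congˡ (sum-++ f xs ys)) (≈-sym (assoc _ _ _))

  sum-map : ∀ {A B} (f : B → Carrier) (g : A → B) xs → sum f (map g xs) ≈ sum (f ∘ g) xs
  sum-map f g xs = reflexive (cong (foldr _∙_ ε) (sym (ListP.map-∘ xs)))

  sum-concatMap : ∀ {A B} (f : B → Carrier) (g : A → List B) xs →
    sum f (concatMap g xs) ≈ sum (λ x → sum f (g x)) xs
  sum-concatMap f g [] = ≈-refl
  sum-concatMap f g (x ∷ xs) = ≈-trans (sum-++ f (g x) (concatMap g xs)) (∙-congˡ (sum-concatMap f g xs))

  sum-swap : ∀ {A B} (f : A → B → Carrier) xs ys →
    sum (λ x → sum (f x) ys) xs ≈ sum (λ y → sum (λ x → f x y) xs) ys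
  sum-swap f [] ys = ≈-sym (sum-ε ys (λ _ → ≈-refl))
  sum-swap f (x ∷ xs) ys = ≈-trans (∙-congˡ (sum-swap f xs ys)) (≈-sym (sum-∙ (f x) _ ys))

  sum-filter : ∀ {A} {P : A → Set} (P? : ∀ x → Dec (P x)) (f : A → Carrier) xs →
    sum f (filter P? xs) ≈ sum (λ x → when (P? x) (f x)) xs
  sum-filter P? f [] = ≈-refl
  sum-filter P? f (x ∷ xs) with does (P? x)
  ... | true = ∙-congˡ (sum-filter P? f xs)
  ... | false = ≈-trans (sum-filter P? f xs) (≈-sym (identityˡ _))

  sum-allFin-suc : ∀ m (f : Fin (suc m) → Carrier) → sum f (allFin (suc m)) ≈ f zero ∙ sum (f ∘ suc) (allFin m)
  sum-allFin-suc m f = ∙-congˡ (reflexive (cong (foldr _∙_ ε)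
    (trans (ListP.map-tabulate suc f) (sym (ListP.map-tabulate id (f ∘ suc))))))

  sum-allFin-single : ∀ m (f : Fin m → Carrier) b → (∀ a → a ≢ b → f a ≈ ε) → sum f (allFin m) ≈ f b
  sum-allFin-single (suc m) f zero f≈ε = begin
    sum f (allFin (suc m))               ≈⟨ sum-allFin-suc m f ⟩
    f zero ∙ sum (f ∘ suc) (allFin m)    ≈⟨ ∙-congˡ (sum-ε (allFin m) (λ a → f≈ε (suc a) λ ())) ⟩
    f zero ∙ ε                           ≈⟨ identityʳ (f zero) ⟩
    f zero                               ∎
  sum-allFin-single (suc m) f (suc b) f≈ε = begin
    sum f (allFin (suc m))               ≈⟨ sum-allFin-suc m f ⟩
    f zero ∙ sum (f ∘ suc) (allFin m)    ≈⟨ ∙-congʳ (f≈ε zero λ ()) ⟩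
    ε ∙ sum (f ∘ suc) (allFin m)         ≈⟨ identityˡ _ ⟩
    sum (f ∘ suc) (allFin m)             ≈⟨ sum-allFin-single m (f ∘ suc) b
                                              (λ a a≢b → f≈ε (suc a) (a≢b ∘ suc-injective)) ⟩
    f (suc b)                            ∎

  sum-allPairs : ∀ m (f : Fin m × Fin m → Carrier) →
    sum f (allPairs m) ≈ sum (λ a → sum (λ b → f (a , b)) (allFin m)) (allFin m)
  sum-allPairs m f = ≈-trans (sum-concatMap f _ (allFin m)) (sum-cong (allFin m) (λ a → sum-map f (a ,_) (allFin m)))

  sum-allPairs-single : ∀ m (f : Fin m × Fin m → Carrier) w → (∀ u → u ≢ w → f u ≈ ε) → sum f (allPairs m) ≈ f w
  sum-allPairs-single m f (a₀ , b₀) f≈ε = begin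
    sum f (allPairs m)
      ≈⟨ sum-allPairs m f ⟩
    sum (λ a → sum (λ b → f (a , b)) (allFin m)) (allFin m)
      ≈⟨ sum-allFin-single m _ a₀ (λ a a≢a₀ → sum-ε (allFin m) (λ b → f≈ε (a , b) (a≢a₀ ∘ cong proj₁))) ⟩
    sum (λ b → f (a₀ , b)) (allFin m)
      ≈⟨ sum-allFin-single m _ b₀ (λ b b≢b₀ → f≈ε (a₀ , b) (b≢b₀ ∘ cong proj₂)) ⟩
    f (a₀ , b₀) ∎

  sum-allPairs-transpose : ∀ m (f : Fin m × Fin m → Carrier) →
    sum f (allPairs m) ≈ sum (λ w → f (proj₂ w , proj₁ w)) (allPairs m)
  sum-allPairs-transpose m f = begin
    sum f (allPairs m)                                            ≈⟨ sum-allPairs m f ⟩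
    sum (λ a → sum (λ b → f (a , b)) (allFin m)) (allFin m)      ≈⟨ sum-swap (λ a b → f (a , b)) (allFin m) (allFin m) ⟩
    sum (λ b → sum (λ a → f (a , b)) (allFin m)) (allFin m)      ≈⟨ sum-allPairs m _ ⟨
    sum (λ w → f (proj₂ w , proj₁ w)) (allPairs m)                ∎

  sum-allSeqs-suc : ∀ n t (f : Vec (Fin n) (suc t) → Carrier) →
    sum f (allSeqs n (suc t)) ≈ sum (λ k → sum (λ ks → f (k ∷ ks)) (allSeqs n t)) (allFin n)
  sum-allSeqs-suc n t f = ≈-trans (sum-concatMap f _ (allFin n)) (sum-cong (allFin n) (λ k → sum-map f (k ∷_) (allSeqs n t)))

  sum-allSeqs-∷ʳ : ∀ n t (f : Vec (Fin n) (suc t) → Carrier) →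
    sum f (allSeqs n (suc t)) ≈ sum (λ k → sum (λ ks → f (ks ∷ʳ k)) (allSeqs n t)) (allFin n)
  sum-allSeqs-∷ʳ n zero f = sum-allSeqs-suc n zero f
  sum-allSeqs-∷ʳ n (suc t) f = begin
    sum f (allSeqs n (suc (suc t)))
      ≈⟨ sum-allSeqs-suc n (suc t) f ⟩
    sum (λ k′ → sum (λ ks → f (k′ ∷ ks)) (allSeqs n (suc t))) (allFin n)
      ≈⟨ sum-cong (allFin n) (λ k′ → sum-allSeqs-∷ʳ n t (λ ks → f (k′ ∷ ks))) ⟩
    sum (λ k′ → sum (λ k → sum (λ ks → f (k′ ∷ (ks ∷ʳ k))) (allSeqs n t)) (allFin n)) (allFin n)
      ≈⟨ sum-swap (λ k′ k → sum (λ ks → f (k′ ∷ (ks ∷ʳ k))) (allSeqs n t)) (allFin n) (allFin n) ⟩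
    sum (λ k → sum (λ k′ → sum (λ ks → f (k′ ∷ (ks ∷ʳ k))) (allSeqs n t)) (allFin n)) (allFin n)
      ≈⟨ sum-cong (allFin n) (λ k → sum-allSeqs-suc n t (λ ks → f (ks ∷ʳ k))) ⟨
    sum (λ k → sum (λ ks → f (ks ∷ʳ k)) (allSeqs n (suc t))) (allFin n) ∎

module _ {c₁ ℓ₁ c₂ ℓ₂} (M : CommutativeMonoid c₁ ℓ₁) (N : CommutativeMonoid c₂ ℓ₂) where
  private
    module M = CommutativeMonoid M
    module N = CommutativeMonoid N

  module _ (h : M.Carrier → N.Carrier) (ε-homo : h M.ε N.≈ N.ε) where

    sum-homo : (∀ x y → h (x M.∙ y) N.≈ h x N.∙ h y) →
      ∀ {A : Set} (f : A → M.Carrier) xs → h (ListSum.sum M f xs) N.≈ ListSum.sum N (h ∘ f) xs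
    sum-homo ∙-homo f [] = ε-homo
    sum-homo ∙-homo f (x ∷ xs) = N.trans (∙-homo _ _) (N.∙-congˡ (sum-homo ∙-homo f xs))

    when-homo : ∀ {p} {P : Set p} (P? : Dec P) x → h (ListSum.when M P? x) N.≈ ListSum.when N P? (h x)
    when-homo (yes _) x = N.refl
    when-homo (no _) x = ε-homo

module ℕΣ = ListSum ℕP.+-0-commutativeMonoid
module ℚΣ = ListSum ℚP.+-0-commutativeMonoid

infixl 8 _/ℕ_
_/ℕ_ : ℕ → (m : ℕ) → .{{NonZero m}} → ℚ
a /ℕ m = + a / m

fromℚᵘ-homo-+ : ∀ p q → fromℚᵘ (p ℚᵘ.+ q) ≡ fromℚᵘ p ℚ.+ fromℚᵘ q
fromℚᵘ-homo-+ p q = ℚP.toℚᵘ-injective (ℚᵘP.≃-trans (ℚP.toℚᵘ-fromℚᵘ (p ℚᵘ.+ q))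
  (ℚᵘP.≃-trans (ℚᵘP.+-cong (ℚᵘP.≃-sym (ℚP.toℚᵘ-fromℚᵘ p)) (ℚᵘP.≃-sym (ℚP.toℚᵘ-fromℚᵘ q)))
               (ℚᵘP.≃-sym (ℚP.toℚᵘ-homo-+ (fromℚᵘ p) (fromℚᵘ q)))))

fromℚᵘ-homo-* : ∀ p q → fromℚᵘ (p ℚᵘ.* q) ≡ fromℚᵘ p ℚ.* fromℚᵘ q
fromℚᵘ-homo-* p q = ℚP.toℚᵘ-injective (ℚᵘP.≃-trans (ℚP.toℚᵘ-fromℚᵘ (p ℚᵘ.* q))
  (ℚᵘP.≃-trans (ℚᵘP.*-cong (ℚᵘP.≃-sym (ℚP.toℚᵘ-fromℚᵘ p)) (ℚᵘP.≃-sym (ℚP.toℚᵘ-fromℚᵘ q)))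
               (ℚᵘP.≃-sym (ℚP.toℚᵘ-homo-* (fromℚᵘ p) (fromℚᵘ q)))))

/ℕ-cross : ∀ a b m k .{{_ : NonZero m}} .{{_ : NonZero k}} → a ℕ.* k ≡ b ℕ.* m → a /ℕ m ≡ b /ℕ k
/ℕ-cross a b (suc m) (suc k) e = ℚP.fromℚᵘ-cong {mkℚᵘ (+ a) m} {mkℚᵘ (+ b) k}
  (*≡* (trans (sym (ℤP.pos-* a (suc k))) (trans (cong +_ e) (ℤP.pos-* b (suc m)))))

/ℕ-homo-+ : ∀ a b m .{{_ : NonZero m}} → (a ℕ.+ b) /ℕ m ≡ a /ℕ m ℚ.+ b /ℕ m
/ℕ-homo-+ a b (suc m) = begin
  (a ℕ.+ b) /ℕ suc m
    ≡⟨ /ℕ-cross (a ℕ.+ b) (a ℕ.* suc m ℕ.+ b ℕ.* suc m) (suc m) (suc m ℕ.* suc m) (cross-multiplied a b (suc m)) ⟩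
  (a ℕ.* suc m ℕ.+ b ℕ.* suc m) /ℕ (suc m ℕ.* suc m)
    ≡⟨ ℚP./-cong (cong₂ ℤ._+_ (ℤP.pos-* a (suc m)) (ℤP.pos-* b (suc m))) refl ⟩
  fromℚᵘ (mkℚᵘ (+ a) m ℚᵘ.+ mkℚᵘ (+ b) m)
    ≡⟨ fromℚᵘ-homo-+ (mkℚᵘ (+ a) m) (mkℚᵘ (+ b) m) ⟩
  a /ℕ suc m ℚ.+ b /ℕ suc m ∎
  where
  open ≡-Reasoning
  cross-multiplied : ∀ a b m → (a ℕ.+ b) ℕ.* (m ℕ.* m) ≡ (a ℕ.* m ℕ.+ b ℕ.* m) ℕ.* m
  cross-multiplied = solve-∀

1/n*a/m≡a/[n*m] : ∀ a n m .{{_ : NonZero n}} .{{_ : NonZero m}} →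
  1 /ℕ n ℚ.* (a /ℕ m) ≡ _/ℕ_ a (n ℕ.* m) {{ℕP.m*n≢0 n m}}
1/n*a/m≡a/[n*m] a (suc n) (suc m) = trans (sym (fromℚᵘ-homo-* (mkℚᵘ (+ 1) n) (mkℚᵘ (+ a) m)))
  (ℚP./-cong (ℤP.*-identityˡ (+ a)) refl)

length≡sum-1 : ∀ {A : Set} (xs : List A) → length xs ≡ ℕΣ.sum (λ _ → 1) xs
length≡sum-1 [] = refl
length≡sum-1 (x ∷ xs) = cong suc (length≡sum-1 xs)

length-filter : ∀ {A : Set} {P : A → Set} (P? : ∀ x → Dec (P x)) xs →
  length (filter P? xs) ≡ ℕΣ.sum (λ x → ℕΣ.when (P? x) 1) xs
length-filter P? xs = trans (length≡sum-1 (filter P? xs)) (ℕΣ.sum-filter P? (λ _ → 1) xs)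

sum-/ℕ : ∀ m .{{_ : NonZero m}} {A : Set} (f : A → ℕ) xs → ℕΣ.sum f xs /ℕ m ≡ ℚΣ.sum (λ x → f x /ℕ m) xs
sum-/ℕ m = sum-homo ℕP.+-0-commutativeMonoid ℚP.+-0-commutativeMonoid (_/ℕ m) (ℚP.0/n≡0 m) (λ a b → /ℕ-homo-+ a b m)

*-sum : ∀ x {A : Set} (f : A → ℚ) xs → x ℚ.* ℚΣ.sum f xs ≡ ℚΣ.sum (λ y → x ℚ.* f y) xs
*-sum x = sum-homo ℚP.+-0-commutativeMonoid ℚP.+-0-commutativeMonoid (x ℚ.*_) (ℚP.*-zeroʳ x) (ℚP.*-distribˡ-+ x)

1/n*n≡1 : ∀ n .{{_ : NonZero n}} → 1 /ℕ n ℚ.* n /ℕ 1 ≡ ℚ.1ℚ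
1/n*n≡1 n = trans (1/n*a/m≡a/[n*m] n n 1) (/ℕ-cross n 1 (n ℕ.* 1) 1 {{ℕP.m*n≢0 n 1}} (sym (ℕP.*-identityˡ (n ℕ.* 1))))

sum-allFin-const : ∀ n (q : ℚ) → ℚΣ.sum (λ _ → q) (allFin n) ≡ n /ℕ 1 ℚ.* q
sum-allFin-const zero q = sym (ℚP.*-zeroˡ q)
sum-allFin-const (suc n) q = begin
  ℚΣ.sum (λ _ → q) (allFin (suc n))  ≡⟨ ℚΣ.sum-allFin-suc n (λ _ → q) ⟩
  q + ℚΣ.sum (λ _ → q) (allFin n)    ≡⟨ cong₂ _+_ (sym (ℚP.*-identityˡ q)) (sum-allFin-const n q) ⟩
  ℚ.1ℚ * q + n /ℕ 1 * q              ≡⟨ ℚP.*-distribʳ-+ q ℚ.1ℚ (n /ℕ 1) ⟨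
  (ℚ.1ℚ + n /ℕ 1) * q                ≡⟨ cong (_* q) (/ℕ-homo-+ 1 n 1) ⟨
  suc n /ℕ 1 * q                     ∎
  where open ≡-Reasoning

average-const : ∀ n .{{_ : NonZero n}} q → ℚΣ.sum (λ _ → 1 /ℕ n ℚ.* q) (allFin n) ≡ q
average-const n q = begin
  ℚΣ.sum (λ _ → 1 /ℕ n * q) (allFin n)  ≡⟨ *-sum (1 /ℕ n) (λ _ → q) (allFin n) ⟨
  1 /ℕ n * ℚΣ.sum (λ _ → q) (allFin n)  ≡⟨ cong (1 /ℕ n *_) (sum-allFin-const n q) ⟩
  1 /ℕ n * (n /ℕ 1 * q)                 ≡⟨ ℚP.*-assoc (1 /ℕ n) (n /ℕ 1) q ⟨
  1 /ℕ n * n /ℕ 1 * q                   ≡⟨ cong (_* q) (1/n*n≡1 n) ⟩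
  ℚ.1ℚ * q                              ≡⟨ ℚP.*-identityˡ q ⟩
  q                                     ∎
  where open ≡-Reasoning

dist[n,n]≡0 : ∀ x → dist x x ≡ 0
dist[n,n]≡0 x = cong₂ ℕ._+_ (ℕP.n∸n≡0 x) (ℕP.n∸n≡0 x)

dist[n,1+n]≡1 : ∀ x → dist x (suc x) ≡ 1
dist[n,1+n]≡1 zero = refl
dist[n,1+n]≡1 (suc x) = dist[n,1+n]≡1 x

dist[1+n,n]≡1 : ∀ x → dist (suc x) x ≡ 1
dist[1+n,n]≡1 x = trans (ℕP.+-comm (suc x ∸ x) (x ∸ suc x)) (dist[n,1+n]≡1 x)

dist≡0⇒≡ : ∀ x y → dist x y ≡ 0 → x ≡ y
dist≡0⇒≡ x y d≡0 = ℕP.≤-antisym (ℕP.m∸n≡0⇒m≤n (ℕP.m+n≡0⇒m≡0 (x ∸ y) d≡0))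
                                 (ℕP.m∸n≡0⇒m≤n (ℕP.m+n≡0⇒n≡0 (x ∸ y) d≡0))

dist≡1⇒consecutive : ∀ x y → dist x y ≡ 1 → y ≡ suc x ⊎ x ≡ suc y
dist≡1⇒consecutive zero (suc zero) _ = inj₁ refl
dist≡1⇒consecutive (suc zero) zero _ = inj₂ refl
dist≡1⇒consecutive (suc x) (suc y) d≡1 with dist≡1⇒consecutive x y d≡1
... | inj₁ y≡1+x = inj₁ (cong suc y≡1+x)
... | inj₂ x≡1+y = inj₂ (cong suc x≡1+y)
dist≡1⇒consecutive zero zero ()
dist≡1⇒consecutive zero (suc (suc y)) ()
dist≡1⇒consecutive (suc (suc x)) zero d≡1 =
  contradiction (ℕP.suc-injective (trans (sym (ℕP.+-identityʳ (suc (suc x)))) d≡1)) ℕP.1+n≢0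

m+n≡1-cases : ∀ m n → m ℕ.+ n ≡ 1 → (m ≡ 0 × n ≡ 1) ⊎ (m ≡ 1 × n ≡ 0)
m+n≡1-cases zero n e = inj₁ (refl , e)
m+n≡1-cases (suc zero) n e = inj₂ (refl , ℕP.suc-injective e)

Cell : ℕ → Set
Cell n = Fin (suc n) × Fin (suc n)

module _ {n : ℕ} (k : Fin n) where

  inject₁≢suc : inject₁ k ≢ suc k
  inject₁≢suc e = ℕP.1+n≢n (trans (sym (cong toℕ e)) (toℕ-inject₁ k))

  s-inject₁ : s k (inject₁ k) ≡ suc k
  s-inject₁ with inject₁ k ≟ inject₁ k
  ... | yes _ = refl
  ... | no k≢k = contradiction refl k≢k

  s-suc : s k (suc k) ≡ inject₁ k
  s-suc with suc k ≟ inject₁ k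
  ... | yes e = contradiction (sym e) inject₁≢suc
  ... | no _ with suc k ≟ suc k
  ...   | yes _ = refl
  ...   | no k≢k = contradiction refl k≢k

  s-fixed : ∀ {x} → x ≢ inject₁ k → x ≢ suc k → s k x ≡ x
  s-fixed {x} x≢k x≢k+1 with x ≟ inject₁ k
  ... | yes e = contradiction e x≢k
  ... | no _ with x ≟ suc k
  ...   | yes e = contradiction e x≢k+1
  ...   | no _ = refl

data Moves {n : ℕ} (k : Fin n) : Fin (suc n) → Set where
  up    : Moves k (inject₁ k)
  down  : Moves k (suc k)
  fixed : ∀ {x} → x ≢ inject₁ k → x ≢ suc k → Moves k x

moves : ∀ {n} (k : Fin n) x → Moves k x
moves k x with x ≟ inject₁ k
... | yes refl = up
... | no x≢k with x ≟ suc k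
...   | yes refl = down
...   | no x≢k+1 = fixed x≢k x≢k+1

s-involutive : ∀ {n} (k : Fin n) x → s k (s k x) ≡ x
s-involutive k x with moves k x
... | up = trans (cong (s k) (s-inject₁ k)) (s-suc k)
... | down = trans (cong (s k) (s-suc k)) (s-inject₁ k)
... | fixed x≢k x≢k+1 = trans (cong (s k) (s-fixed k x≢k x≢k+1)) (s-fixed k x≢k x≢k+1)

s-injective : ∀ {n} (k : Fin n) {x y} → s k x ≡ s k y → x ≡ y
s-injective k {x} {y} e = trans (sym (s-involutive k x)) (trans (cong (s k) e) (s-involutive k y))

index-of-moved : ∀ {n} (k : Fin n) x → s k x ≢ x → toℕ k ≡ toℕ x ⊓ toℕ (s k x)
index-of-moved k x sx≢x with moves k x
... | up rewrite s-inject₁ k | toℕ-inject₁ k = sym (ℕP.m≤n⇒m⊓n≡m (ℕP.n≤1+n (toℕ k)))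
... | down rewrite s-suc k | toℕ-inject₁ k = sym (ℕP.m≥n⇒m⊓n≡n (ℕP.n≤1+n (toℕ k)))
... | fixed x≢k x≢k+1 = contradiction (s-fixed k x≢k x≢k+1) sx≢x

s×s : ∀ {n} → Fin n → Cell n → Cell n
s×s k (i , j) = s k i , s k j

s-unique : ∀ {n} (k k′ : Fin n) x → s k x ≡ s k′ x → s k x ≢ x → k ≡ k′
s-unique k k′ x e moved = toℕ-injective (begin
  toℕ k                  ≡⟨ index-of-moved k x moved ⟩
  toℕ x ⊓ toℕ (s k x)   ≡⟨ cong (λ y → toℕ x ⊓ toℕ y) e ⟩
  toℕ x ⊓ toℕ (s k′ x)  ≡⟨ sym (index-of-moved k′ x (λ e′ → moved (trans e e′))) ⟩
  toℕ k′                 ∎)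
  where open ≡-Reasoning

s×s-unique : ∀ {n} (k k′ : Fin n) (v : Cell n) → s×s k v ≡ s×s k′ v → s×s k v ≢ v → k ≡ k′
s×s-unique k k′ (i , j) e moved with s k i ≟ i | s k j ≟ j
... | no i-moved | _ = s-unique k k′ i (cong proj₁ e) i-moved
... | yes _ | no j-moved = s-unique k k′ j (cong proj₂ e) j-moved
... | yes i-fixed | yes j-fixed = contradiction (cong₂ _,_ i-fixed j-fixed) moved

consecutive : ∀ {n} {x y : Fin (suc n)} → toℕ y ≡ suc (toℕ x) → ∃ λ k → x ≡ inject₁ k × y ≡ suc k
consecutive {y = suc k} e = k , toℕ-injective (trans (ℕP.suc-injective (sym e)) (sym (toℕ-inject₁ k))) , refl

dist-s : ∀ {n} (k : Fin n) x → s k x ≢ x → dist (toℕ x) (toℕ (s k x)) ≡ 1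
dist-s k x moved with moves k x
... | up rewrite s-inject₁ k | toℕ-inject₁ k = dist[n,1+n]≡1 (toℕ k)
... | down rewrite s-suc k | toℕ-inject₁ k = dist[1+n,n]≡1 (toℕ k)
... | fixed x≢k x≢k+1 = contradiction (s-fixed k x≢k x≢k+1) moved

dist-fixed : ∀ {n} {x y : Fin n} → y ≡ x → dist (toℕ x) (toℕ y) ≡ 0
dist-fixed {x = x} refl = dist[n,n]≡0 (toℕ x)

s-moves-one : ∀ {n} {x x′ y : Fin (suc n)} → y ≢ x → y ≢ x′ → dist (toℕ x) (toℕ x′) ≡ 1 →
  ∃ λ (k : Fin n) → s k x ≡ x′ × s k y ≡ y
s-moves-one {x = x} {x′} y≢x y≢x′ d≡1 with dist≡1⇒consecutive (toℕ x) (toℕ x′) d≡1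
... | inj₁ x′≡1+x with consecutive x′≡1+x
...   | k , refl , refl = k , s-inject₁ k , s-fixed k y≢x y≢x′
s-moves-one {x = x} {x′} y≢x y≢x′ d≡1 | inj₂ x≡1+x′ with consecutive x≡1+x′
...   | k , refl , refl = k , s-suc k , s-fixed k y≢x′ y≢x

adjacent⇒transposition : ∀ {n} {i j i′ j′ : Fin (suc n)} → i ≢ j → i′ ≢ j′ →
  Adj n (i , j) (i′ , j′) → ∃ λ (k : Fin n) → s×s k (i , j) ≡ (i′ , j′)
adjacent⇒transposition _ _ (inj₂ (k , inj₁ ((refl , refl) , (refl , refl)))) =
  k , cong₂ _,_ (s-inject₁ k) (s-suc k)
adjacent⇒transposition _ _ (inj₂ (k , inj₂ ((refl , refl) , (refl , refl)))) =
  k , cong₂ _,_ (s-suc k) (s-inject₁ k)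
adjacent⇒transposition {i = i} {j} {i′} {j′} i≢j i′≢j′ (inj₁ d≡1)
  with m+n≡1-cases (dist (toℕ i) (toℕ i′)) (dist (toℕ j) (toℕ j′)) d≡1
... | inj₁ (di≡0 , dj≡1) with toℕ-injective {i = i} {i′} (dist≡0⇒≡ _ _ di≡0)
...   | refl with s-moves-one i≢j i′≢j′ dj≡1
...     | k , j↦j′ , i↦i = k , cong₂ _,_ i↦i j↦j′
adjacent⇒transposition {i = i} {j} {i′} {j′} i≢j i′≢j′ (inj₁ d≡1)
    | inj₂ (di≡1 , dj≡0) with toℕ-injective {i = j} {j′} (dist≡0⇒≡ _ _ dj≡0)
...   | refl with s-moves-one (λ e → i≢j (sym e)) (λ e → i′≢j′ (sym e)) di≡1
...     | k , i↦i′ , j↦j = k , cong₂ _,_ i↦i′ j↦j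

transposition⇒adjacent : ∀ {n} (k : Fin n) {i j} → i ≢ j → s×s k (i , j) ≢ (i , j) →
  Adj n (i , j) (s×s k (i , j))
transposition⇒adjacent k {i} {j} i≢j moved with s k i ≟ i | s k j ≟ j
... | yes i-fixed | yes j-fixed = contradiction (cong₂ _,_ i-fixed j-fixed) moved
... | no i-moved | yes j-fixed = inj₁ (cong₂ ℕ._+_ (dist-s k i i-moved) (dist-fixed j-fixed))
... | yes i-fixed | no j-moved = inj₁ (cong₂ ℕ._+_ (dist-fixed i-fixed) (dist-s k j j-moved))
... | no i-moved | no j-moved = inj₂ (k , swaps (moves k i) (moves k j))
  where
  swaps : Moves k i → Moves k j →
    ((i ≡ inject₁ k × j ≡ suc k) × (s k i ≡ suc k × s k j ≡ inject₁ k))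
    ⊎ ((i ≡ suc k × j ≡ inject₁ k) × (s k i ≡ inject₁ k × s k j ≡ suc k))
  swaps up down = inj₁ ((refl , refl) , (s-inject₁ k , s-suc k))
  swaps down up = inj₂ ((refl , refl) , (s-suc k , s-inject₁ k))
  swaps up up = contradiction refl i≢j
  swaps down down = contradiction refl i≢j
  swaps (fixed i≢k i≢k+1) _ = contradiction (s-fixed k i≢k i≢k+1) i-moved
  swaps _ (fixed j≢k j≢k+1) = contradiction (s-fixed k j≢k j≢k+1) j-moved

_≟ᶜ_ : ∀ {n} (v w : Cell n) → Dec (v ≡ w)
_≟ᶜ_ = ≡-dec _≟_ _≟_

module NeighbourSum {c ℓ} (M : CommutativeMonoid c ℓ) where

  open CommutativeMonoid M renaming (refl to ≈-refl; sym to ≈-sym; trans to ≈-trans)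
  open ListSum M
  open import Relation.Binary.Reasoning.Setoid setoid

  sum-when-≡ : ∀ {n} (f : Cell n → Carrier) u → sum (λ w → when (w ≟ᶜ u) (f w)) (allPairs (suc n)) ≈ f u
  sum-when-≡ {n} f u =
    ≈-trans (sum-allPairs-single (suc n) _ u (λ w w≢u → when-no (w ≟ᶜ u) w≢u)) (when-yes (u ≟ᶜ u) refl)

  module _ {n : ℕ} (v : Cell n) (off-diagonal : proj₁ v ≢ proj₂ v) (g : Cell n → Carrier) (g[v]≈ε : g v ≈ ε) where

    sum-hits≈when-neighbour : ∀ w (nb? : Dec (proj₁ w ≢ proj₂ w × Adj n v w)) →
      sum (λ k → when (w ≟ᶜ s×s k v) (g w)) (allFin n) ≈ when nb? (g w)
    sum-hits≈when-neighbour w nb? with w ≟ᶜ v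
    ... | yes refl = ≈-trans (sum-ε (allFin n) (λ k → when-ε (w ≟ᶜ s×s k v) g[v]≈ε)) (≈-sym (when-ε nb? g[v]≈ε))
    ... | no w≢v with nb?
    ...   | no not-nb = sum-ε (allFin n) (λ k → when-no (w ≟ᶜ s×s k v) (λ w≡kv → not-nb (neighbour k w≡kv)))
      where
      neighbour : ∀ k → w ≡ s×s k v → proj₁ w ≢ proj₂ w × Adj n v w
      neighbour k refl = (off-diagonal ∘ s-injective k)
                       , transposition⇒adjacent k off-diagonal w≢v
    ...   | yes (w-off , adj) with adjacent⇒transposition off-diagonal w-off adj
    ...     | k₀ , k₀v≡w = ≈-trans (sum-allFin-single n _ k₀ other-k) (when-yes (w ≟ᶜ s×s k₀ v) (sym k₀v≡w))
      where
      other-k : ∀ k → k ≢ k₀ → when (w ≟ᶜ s×s k v) (g w) ≈ ε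
      other-k k k≢k₀ = when-no (w ≟ᶜ s×s k v) (λ w≡kv → k≢k₀
        (s×s-unique k k₀ v (trans (sym w≡kv) (sym k₀v≡w)) (λ kv≡v → w≢v (trans w≡kv kv≡v))))

    sum-transpositions≈sum-neighbours : sum (λ k → g (s×s k v)) (allFin n) ≈ sum g (neighbours n v)
    sum-transpositions≈sum-neighbours = begin
      sum (λ k → g (s×s k v)) (allFin n)
        ≈⟨ sum-cong (allFin n) (λ k → sum-when-≡ g (s×s k v)) ⟨
      sum (λ k → sum (λ w → when (w ≟ᶜ s×s k v) (g w)) (allPairs (suc n))) (allFin n)
        ≈⟨ sum-swap _ (allFin n) (allPairs (suc n)) ⟩
      sum (λ w → sum (λ k → when (w ≟ᶜ s×s k v) (g w)) (allFin n)) (allPairs (suc n))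
        ≈⟨ sum-cong (allPairs (suc n)) (λ w → sum-hits≈when-neighbour w (¬? (proj₁ w ≟ proj₂ w) ×-dec adj? n v w)) ⟩
      sum (λ w → when (¬? (proj₁ w ≟ proj₂ w) ×-dec adj? n v w) (g w)) (allPairs (suc n))
        ≈⟨ sum-filter _ g (allPairs (suc n)) ⟨
      sum g (neighbours n v) ∎

word-∷ʳ : ∀ {n t} (ks : Vec (Fin n) t) k x → word (ks ∷ʳ k) x ≡ word ks (s k x)
word-∷ʳ [] k x = refl
word-∷ʳ (k′ ∷ ks) k x = cong (s k′) (word-∷ʳ ks k x)

count : ∀ n t → Fin (suc n) → Fin (suc n) → ℕ
count n t i j = length (filter (λ ks → word ks i <? word ks j) (allSeqs n t))

count-suc : ∀ n t i j → count n (suc t) i j ≡ ℕΣ.sum (λ k → count n t (s k i) (s k j)) (allFin n)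
count-suc n t i j = begin
  count n (suc t) i j
    ≡⟨ length-filter _ (allSeqs n (suc t)) ⟩
  ℕΣ.sum (λ ks → [ word ks i < word ks j ]) (allSeqs n (suc t))
    ≡⟨ ℕΣ.sum-allSeqs-∷ʳ n t _ ⟩
  ℕΣ.sum (λ k → ℕΣ.sum (λ ks → [ word (ks ∷ʳ k) i < word (ks ∷ʳ k) j ]) (allSeqs n t)) (allFin n)
    ≡⟨ ℕΣ.sum-cong (allFin n) (λ k → ℕΣ.sum-cong (allSeqs n t) (λ ks →
         cong₂ [_<_] (word-∷ʳ ks k i) (word-∷ʳ ks k j))) ⟩
  ℕΣ.sum (λ k → ℕΣ.sum (λ ks → [ word ks (s k i) < word ks (s k j) ]) (allSeqs n t)) (allFin n)
    ≡⟨ ℕΣ.sum-cong (allFin n) (λ k → sym (length-filter _ (allSeqs n t))) ⟩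
  ℕΣ.sum (λ k → count n t (s k i) (s k j)) (allFin n) ∎
  where
  open ≡-Reasoning
  [_<_] : Fin (suc n) → Fin (suc n) → ℕ
  [ a < b ] = ℕΣ.when (a <? b) 1

open NeighbourSum ℚP.+-0-commutativeMonoid using (sum-transpositions≈sum-neighbours)

p-suc : ∀ n .{{_ : NonZero n}} t i j → p n (suc t) i j ≡ ℚΣ.sum (λ k → 1 /ℕ n ℚ.* p n t (s k i) (s k j)) (allFin n)
p-suc n t i j = begin
  p n (suc t) i j
    ≡⟨ cong (_/ℕ (n ℕ.* n ^ t)) (count-suc n t i j) ⟩
  ℕΣ.sum (λ k → count n t (s k i) (s k j)) (allFin n) /ℕ (n ℕ.* n ^ t)
    ≡⟨ sum-/ℕ (n ℕ.* n ^ t) _ (allFin n) ⟩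
  ℚΣ.sum (λ k → count n t (s k i) (s k j) /ℕ (n ℕ.* n ^ t)) (allFin n)
    ≡⟨ ℚΣ.sum-cong (allFin n) (λ k → sym (1/n*a/m≡a/[n*m] (count n t (s k i) (s k j)) n (n ^ t))) ⟩
  ℚΣ.sum (λ k → 1 /ℕ n ℚ.* p n t (s k i) (s k j)) (allFin n) ∎
  where
  open ≡-Reasoning
  instance
    n^t≢0 : NonZero (n ^ t)
    n^t≢0 = ℕP.m^n≢0 n t
    n^[1+t]≢0 : NonZero (n ℕ.* n ^ t)
    n^[1+t]≢0 = ℕP.m^n≢0 n (suc t)

heat-equation : ∀ n .{{_ : NonZero n}} t (i j : Fin (suc n)) → i ≢ j →
  p n (suc t) i j ≡ p n t i j + (+ 1 / n) * Σℚ (map (λ w → p n t (proj₁ w) (proj₂ w) - p n t i j) (neighbours n (i , j)))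
heat-equation n t i j i≢j = begin
  p n (suc t) i j
    ≡⟨ p-suc n t i j ⟩
  ℚΣ.sum (λ k → x * q (s×s k v)) (allFin n)
    ≡⟨ ℚΣ.sum-cong (allFin n) (λ k → split (q (s×s k v))) ⟩
  ℚΣ.sum (λ k → x * g (s×s k v) + x * q v) (allFin n)
    ≡⟨ ℚΣ.sum-∙ _ _ (allFin n) ⟩
  ℚΣ.sum (λ k → x * g (s×s k v)) (allFin n) + ℚΣ.sum (λ _ → x * q v) (allFin n)
    ≡⟨ cong₂ _+_ (sym (*-sum x _ (allFin n))) (average-const n (q v)) ⟩
  x * ℚΣ.sum (λ k → g (s×s k v)) (allFin n) + q v
    ≡⟨ cong (λ σ → x * σ + q v) (sum-transpositions≈sum-neighbours v i≢j g (ℚP.+-inverseʳ (q v))) ⟩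
  x * ℚΣ.sum g (neighbours n v) + q v
    ≡⟨ ℚP.+-comm _ (q v) ⟩
  q v + x * ℚΣ.sum g (neighbours n v) ∎
  where
  open ≡-Reasoning
  instance
    n^t≢0 : NonZero (n ^ t)
    n^t≢0 = ℕP.m^n≢0 n t
  v : Cell n
  v = i , j
  x : ℚ
  x = 1 /ℕ n
  q g : Cell n → ℚ
  q w = p n t (proj₁ w) (proj₂ w)
  g w = q w - q v
  split : ∀ a → x * a ≡ x * (a - q v) + x * q v
  split a = trans (cong (x *_) (sym (//-rightDividesˡ (q v) a))) (ℚP.*-distribˡ-+ x (a - q v) (q v))

inversions-at : ∀ n t (a b : Fin (suc n)) →
  ℕΣ.sum (λ ks → ℕΣ.when ((a <? b) ×-dec (word ks b <? word ks a)) 1) (allSeqs n t) ≡ ℕΣ.when (a <? b) (count n t b a)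
inversions-at n t a b = begin
  ℕΣ.sum (λ ks → ℕΣ.when ((a <? b) ×-dec (word ks b <? word ks a)) 1) (allSeqs n t)
    ≡⟨ ℕΣ.sum-cong (allSeqs n t) (λ ks → ℕΣ.when-×-dec (a <? b) (word ks b <? word ks a) 1) ⟩
  ℕΣ.sum (λ ks → ℕΣ.when (a <? b) (ℕΣ.when (word ks b <? word ks a) 1)) (allSeqs n t)
    ≡⟨ ℕΣ.sum-when (a <? b) _ (allSeqs n t) ⟩
  ℕΣ.when (a <? b) (ℕΣ.sum (λ ks → ℕΣ.when (word ks b <? word ks a) 1) (allSeqs n t))
    ≡⟨ cong (ℕΣ.when (a <? b)) (length-filter _ (allSeqs n t)) ⟨
  ℕΣ.when (a <? b) (count n t b a) ∎
  where open ≡-Reasoning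

sum-inversions : ∀ n t →
  ℕΣ.sum inversions (allSeqs n t) ≡
    ℕΣ.sum (λ w → ℕΣ.when (proj₂ w <? proj₁ w) (count n t (proj₁ w) (proj₂ w))) (allPairs (suc n))
sum-inversions n t = begin
  ℕΣ.sum inversions (allSeqs n t)
    ≡⟨ ℕΣ.sum-cong (allSeqs n t) (λ ks → length-filter (inverted ks) (allPairs (suc n))) ⟩
  ℕΣ.sum (λ ks → ℕΣ.sum (λ w → [ ks ∣ w ]) (allPairs (suc n))) (allSeqs n t)
    ≡⟨ ℕΣ.sum-swap [_∣_] (allSeqs n t) (allPairs (suc n)) ⟩
  ℕΣ.sum (λ w → ℕΣ.sum (λ ks → [ ks ∣ w ]) (allSeqs n t)) (allPairs (suc n))
    ≡⟨ ℕΣ.sum-cong (allPairs (suc n)) (λ w → inversions-at n t (proj₁ w) (proj₂ w)) ⟩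
  ℕΣ.sum (λ w → ℕΣ.when (proj₁ w <? proj₂ w) (count n t (proj₂ w) (proj₁ w))) (allPairs (suc n))
    ≡⟨ ℕΣ.sum-allPairs-transpose (suc n) (λ w → ℕΣ.when (proj₁ w <? proj₂ w) (count n t (proj₂ w) (proj₁ w))) ⟩
  ℕΣ.sum (λ w → ℕΣ.when (proj₂ w <? proj₁ w) (count n t (proj₁ w) (proj₂ w))) (allPairs (suc n)) ∎
  where
  open ≡-Reasoning
  inverted : (ks : Vec (Fin n) t) (w : Cell n) → Dec (proj₁ w < proj₂ w × word ks (proj₂ w) < word ks (proj₁ w))
  inverted ks w = (proj₁ w <? proj₂ w) ×-dec (word ks (proj₂ w) <? word ks (proj₁ w))
  [_∣_] : Vec (Fin n) t → Cell n → ℕ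
  [ ks ∣ w ] = ℕΣ.when (inverted ks w) 1

expected-inversions : ∀ n .{{_ : NonZero n}} t → expectedInversions n t ≡ heatBelowDiagonal n t
expected-inversions n t = begin
  expectedInversions n t
    ≡⟨ cong (_/ℕ (n ^ t)) (sum-inversions n t) ⟩
  ℕΣ.sum (λ w → ℕΣ.when (below w) (count n t (proj₁ w) (proj₂ w))) (allPairs (suc n)) /ℕ (n ^ t)
    ≡⟨ sum-/ℕ (n ^ t) (λ w → ℕΣ.when (below w) (count n t (proj₁ w) (proj₂ w))) (allPairs (suc n)) ⟩
  ℚΣ.sum (λ w → ℕΣ.when (below w) (count n t (proj₁ w) (proj₂ w)) /ℕ (n ^ t)) (allPairs (suc n))
    ≡⟨ ℚΣ.sum-cong (allPairs (suc n)) (λ w → when-homo ℕP.+-0-commutativeMonoid ℚP.+-0-commutativeMonoid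
         (_/ℕ (n ^ t)) (ℚP.0/n≡0 (n ^ t)) (below w) (count n t (proj₁ w) (proj₂ w))) ⟩
  ℚΣ.sum (λ w → ℚΣ.when (below w) (p n t (proj₁ w) (proj₂ w))) (allPairs (suc n))
    ≡⟨ ℚΣ.sum-filter below (λ w → p n t (proj₁ w) (proj₂ w)) (allPairs (suc n)) ⟨
  heatBelowDiagonal n t ∎
  where
  open ≡-Reasoning
  instance
    n^t≢0 : NonZero (n ^ t)
    n^t≢0 = ℕP.m^n≢0 n t
  below : (w : Cell n) → Dec (proj₂ w < proj₁ w)
  below w = proj₂ w <? proj₁ w

proposition1 : (n : ℕ) → .{{_ : NonZero n}} →
    ((t : ℕ) → (i j : Fin (suc n)) → i ≢ j →
      p n (suc t) i j ≡
        p n t i j + ((+ 1) / n) * Σℚ (map (λ w → p n t (proj₁ w) (proj₂ w) - p n t i j) (neighbours n (i , j))))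
    × ((t : ℕ) → expectedInversions n t ≡ heatBelowDiagonal n t)
proposition1 n = heat-equation n , expected-inversions n
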